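{- Let $m$ be a positive integer. With respect to the bases $\mathbf{F}^{\blacktriangle}_m$ and $\mathbf{H}^{\blacktriangle}_m$ of $\mathbb{R}^{m+1}$ defined below, the following hold (all indices $i,j$ run over $0,\dots,m$): (1) the change of basis matrix from $\mathbf{F}^{\blacktriangle}_m$ to $\mathbf{H}^{\blacktriangle}_m$ has $(i,j)$th entry $(-1)^j2^{m-j-i}\binom{m-i}{j}$; (2) the change of basis matrix from $\mathbf{H}^{\blacktriangle}_m$ to $\mathbf{F}^{\blacktriangle}_m$ has $(i,j)$th entry $(-1)^{m-j}2^{i+j-m}\binom{i}{m-j}$.
   Context: All vectors are row vectors in $\mathbb{R}^{m+1}$ with components indexed $0,\dots,m$; matrices are $(m+1)\times(m+1)$ with rows and columns indexed from $0$. Binomial coefficients $\binom{a}{b}$ with $a\ge 0$ are $0$ when $b<0$ or $b>a$ (so entries with a negative power of $2$ are $0$). The basis $\mathbf{F}^{\blacktriangle}_m=(\varphi^{\blacktriangle}(0;m),\dots,\varphi^{\blacktriangle}(m;m))$ has $\varphi^{\blacktriangle}(i;m)$ with $j$th component $\binom{i}{j}$. The basis $\mathbf{H}^{\blacktriangle}_m=(\vartheta^{\blacktriangle}(0;m),\dots,\vartheta^{\blacktriangle}(m;m))$ has $\vartheta^{\blacktriangle}(i;m)$ with $j$th component $(-1)^j\binom{m-i}{j}$. For bases $\mathfrak{B}=(b_0,\dots,b_m)$ and $\mathfrak{B}'=(b'_0,\dots,b'_m)$, the change of basis matrix from $\mathfrak{B}$ to $\mathfrak{B}'$ is the matrix whose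 $i$th row is the coordinate vector $(\kappa_0,\dots,\kappa_m)$ of $b'_i$ with respect to $\mathfrak{B}$, i.e. the unique reals with $\sum_k\kappa_k b_k=b'_i$.
   Formalization: Vectors are taken in ℚ^(m+1) instead of $\mathbb{R}^{m+1}$, so uniqueness of the coordinate vectors defining a change of basis matrix is required only among rational vectors. -}

module Defs where

open import Data.Nat as ℕ using (ℕ; zero; suc; _∸_)
open import Data.Nat.Properties using (m^n≢0)
open import Data.Nat.Combinatorics using (_C_)
open import Data.Integer as ℤ using (ℤ; +_; -[1+_])
open import Data.Rational as ℚ using (ℚ; 0ℚ; 1ℚ; _+_; _*_; -_)
open import Data.Fin using (Fin; zero; suc; toℕ)
open import Data.Product using (_×_)
open import Relation.Binary.PropositionalEquality using (_≡_)

-- a vector of ℝ^{m+1} (here with rational entries), components indexed 0..m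
Vec′ : ℕ → Set
Vec′ m = Fin (suc m) → ℚ

Family : ℕ → Set
Family m = Fin (suc m) → Vec′ m

Matrix : ℕ → Set
Matrix m = Fin (suc m) → Fin (suc m) → ℚ

ℕ→ℚ : ℕ → ℚ
ℕ→ℚ n = (+ n) ℚ./ 1

neg1^ : ℕ → ℚ
neg1^ zero    = 1ℚ
neg1^ (suc n) = - neg1^ n

two^ : ℤ → ℚ
two^ (+ n)      = ℕ→ℚ (2 ℕ.^ n)
two^ -[1+ n ]   = ℚ._/_ (+ 1) (2 ℕ.^ suc n) {{m^n≢0 2 (suc n)}}

Σ : ∀ {n} → (Fin n → ℚ) → ℚ
Σ {zero}  f = 0ℚ
Σ {suc n} f = f zero + Σ (λ k → f (suc k))

lincomb : ∀ {m} → Vec′ m → Family m → Vec′ m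
lincomb κ b j = Σ (λ k → κ k * b k j)

-- C is the change of basis matrix from 𝔅 to 𝔅′: its i-th row is the
-- (unique) coordinate vector of b′_i with respect to 𝔅.
IsChangeOfBasisMatrix : ∀ {m} → Family m → Family m → Matrix m → Set
IsChangeOfBasisMatrix {m} B B′ C =
  ∀ i → (∀ j → lincomb (C i) B j ≡ B′ i j)
      × (∀ (κ : Vec′ m) → (∀ j → lincomb κ B j ≡ B′ i j) → ∀ k → κ k ≡ C i k)

F▲ : (m : ℕ) → Family m
F▲ m i j = ℕ→ℚ (toℕ i C toℕ j)

H▲ : (m : ℕ) → Family m
H▲ m i j = neg1^ (toℕ j) * ℕ→ℚ ((m ∸ toℕ i) C toℕ j)

M₁ : (m : ℕ) → Matrix m
M₁ m i j = neg1^ (toℕ j)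
         * (two^ ((+ m) ℤ.- (+ toℕ j) ℤ.- (+ toℕ i))
         * ℕ→ℚ ((m ∸ toℕ i) C toℕ j))

M₂ : (m : ℕ) → Matrix m
M₂ m i j = neg1^ (m ∸ toℕ j)
         * (two^ ((+ toℕ i) ℤ.+ (+ toℕ j) ℤ.- (+ m))
         * ℕ→ℚ (toℕ i C (m ∸ toℕ j)))

-- Read a vector (c_j) as the polynomial Σ c_j t^j. Then φ▲(i) is (1+t)^i and ϑ▲(i) is (1-t)^(m-i), and
-- parts (1) and (2) are the binomial expansions of (1-t)^n = (2 - (1+t))^n and (1+t)^i = (2 - (1-t))^i.
-- On coefficients both are instances of the product rule P_x P_y = P_(x+y) for the generalised Pascal
-- matrices P_x(n,k) = C(n,k) x^(n-k), at (x, y) = (2, -1). At (1, -1) the product is P_0, the identity,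
-- which gives explicit right inverses of F▲ and H▲ and hence uniqueness of coordinates.

module Submission where

open import Defs
open import Data.Nat using (ℕ; NonZero)
open import Data.Product using (_×_)

open import Data.Nat using (zero; suc; _∸_; _^_; _≤_; _<_; s≤s; _≤?_)
import Data.Nat as ℕ
import Data.Nat.Properties as ℕₚ
open import Data.Nat.Combinatorics using (_C_; k>n⇒nCk≡0; nCk+nC[k+1]≡[n+1]C[k+1])
open import Data.Nat.Coprimality as Coprime using (1-coprimeTo)
open import Data.Integer as ℤ using (+_)
import Data.Integer.Properties as ℤₚ
import Data.Integer.Solver as ℤ-Solver
open import Data.Rational as ℚ using (ℚ; 0ℚ; 1ℚ; _+_; _*_; -_; mkℚ)
import Data.Rational.Properties as ℚₚ
open import Data.Rational.Solver using (module +-*-Solver)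
open import Data.Fin using (Fin; zero; suc; toℕ; opposite)
open import Data.Fin.Properties using (toℕ≤pred[n]; opposite-prop)
open import Data.Fin.Permutation using (reverse)
open import Data.Product using (_,_)
open import Algebra.Bundles using (Ring)
open import Algebra.Properties.Semiring.Sum (Ring.semiring ℚₚ.+-*-ring)
  using ( sum; sum-syntax; sum-cong-≗; sum-replicate-zero; ∑-distrib-+; ∑-comm; ∑-permute
        ; *-distribˡ-sum; *-distribʳ-sum )
open import Function using (_∘_)
open import Relation.Nullary using (yes; no; contradiction)
open import Relation.Binary.PropositionalEquality hiding (J)
open ≡-Reasoning

ℕ→ℚ≡mkℚ : ∀ n → ℕ→ℚ n ≡ mkℚ (+ n) 0 (Coprime.sym (1-coprimeTo n))
ℕ→ℚ≡mkℚ n = ℚₚ.normalize-coprime (Coprime.sym (1-coprimeTo n))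

ℕ→ℚ-homo-+ : ∀ a b → ℕ→ℚ (a ℕ.+ b) ≡ ℕ→ℚ a + ℕ→ℚ b
ℕ→ℚ-homo-+ a b = begin
  (+ (a ℕ.+ b)) ℚ./ 1                   ≡⟨ cong (ℚ._/ 1) (ℤₚ.pos-+ a b) ⟩
  (+ a ℤ.+ + b) ℚ./ 1                   ≡⟨ cong₂ (λ u v → (u ℤ.+ v) ℚ./ 1) (sym (ℤₚ.*-identityʳ (+ a)))
                                                                            (sym (ℤₚ.*-identityʳ (+ b))) ⟩
  (+ a ℤ.* + 1 ℤ.+ + b ℤ.* + 1) ℚ./ 1   ≡⟨ sym (cong₂ _+_ (ℕ→ℚ≡mkℚ a) (ℕ→ℚ≡mkℚ b)) ⟩
  ℕ→ℚ a + ℕ→ℚ b                        ∎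

ℕ→ℚ-homo-* : ∀ a b → ℕ→ℚ (a ℕ.* b) ≡ ℕ→ℚ a * ℕ→ℚ b
ℕ→ℚ-homo-* a b =
  trans (cong (ℚ._/ 1) (ℤₚ.pos-* a b)) (sym (cong₂ _*_ (ℕ→ℚ≡mkℚ a) (ℕ→ℚ≡mkℚ b)))

∑-linear : ∀ {n} a (f g : Fin n → ℚ) →
           ∑[ k < n ] (a * f k + g k) ≡ a * ∑[ k < n ] f k + ∑[ k < n ] g k
∑-linear a f g = trans (∑-distrib-+ (λ k → a * f k) g) (cong (_+ sum g) (sym (*-distribˡ-sum a f)))

Σ≡sum : ∀ {n} (f : Fin n → ℚ) → Σ f ≡ sum f
Σ≡sum {zero}  f = refl
Σ≡sum {suc n} f = cong (_+_ (f zero)) (Σ≡sum (λ k → f (suc k)))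

sum-reverse : ∀ m (g : ℕ → ℚ) → ∑[ k < suc m ] g (m ∸ toℕ k) ≡ ∑[ k < suc m ] g (toℕ k)
sum-reverse m g = begin
  ∑[ k < suc m ] g (m ∸ toℕ k)          ≡⟨ sum-cong-≗ (λ k → cong g (sym (opposite-prop k))) ⟩
  ∑[ k < suc m ] g (toℕ (opposite k))   ≡⟨ sym (∑-permute (λ k → g (toℕ k)) reverse) ⟩
  ∑[ k < suc m ] g (toℕ k)              ∎

δ : ℕ → ℕ → ℚ
δ zero    zero    = 1ℚ
δ zero    (suc n) = 0ℚ
δ (suc m) zero    = 0ℚ
δ (suc m) (suc n) = δ m n

δ-refl : ∀ n → δ n n ≡ 1ℚ
δ-refl zero    = refl
δ-refl (suc n) = δ-refl n

δ-≢ : ∀ {m n} → m ≢ n → δ m n ≡ 0ℚ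
δ-≢ {zero}  {zero}  m≢n = contradiction refl m≢n
δ-≢ {zero}  {suc n} m≢n = refl
δ-≢ {suc m} {zero}  m≢n = refl
δ-≢ {suc m} {suc n} m≢n = δ-≢ (m≢n ∘ cong suc)

δ-∸ : ∀ {m k l} → k ≤ m → l ≤ m → δ (m ∸ k) (m ∸ l) ≡ δ k l
δ-∸ {m} {k} {l} k≤m l≤m with k ℕₚ.≟ l
... | yes refl = trans (δ-refl (m ∸ k)) (sym (δ-refl k))
... | no  k≢l  = trans (δ-≢ (k≢l ∘ ℕₚ.∸-cancelˡ-≡ k≤m l≤m)) (sym (δ-≢ k≢l))

sum-δ : ∀ {n} (κ : Fin n → ℚ) l → ∑[ k < n ] (κ k * δ (toℕ k) (toℕ l)) ≡ κ l
sum-δ {suc n} κ zero = begin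
  κ zero * 1ℚ + ∑[ k < n ] (κ (suc k) * 0ℚ)
    ≡⟨ cong₂ _+_ (ℚₚ.*-identityʳ (κ zero)) (sum-cong-≗ (λ k → ℚₚ.*-zeroʳ (κ (suc k)))) ⟩
  κ zero + ∑[ k < n ] 0ℚ    ≡⟨ cong (_+_ (κ zero)) (sum-replicate-zero n) ⟩
  κ zero + 0ℚ               ≡⟨ ℚₚ.+-identityʳ (κ zero) ⟩
  κ zero                    ∎
sum-δ {suc n} κ (suc l) =
  trans (cong₂ _+_ (ℚₚ.*-zeroʳ (κ zero)) (sum-δ (λ k → κ (suc k)) l)) (ℚₚ.+-identityˡ (κ (suc l)))

neg1^-involutive : ∀ n x → neg1^ n * (neg1^ n * x) ≡ x
neg1^-involutive zero    x = trans (ℚₚ.*-identityˡ _) (ℚₚ.*-identityˡ x)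
neg1^-involutive (suc n) x =
  trans (solve 2 (λ s x → (:- s) :* ((:- s) :* x) := s :* (s :* x)) refl (neg1^ n) x)
        (neg1^-involutive n x)
  where open +-*-Solver

shift : (ℕ → ℚ) → ℕ → ℚ
shift f zero    = 0ℚ
shift f (suc j) = f j

-- pascal x n j is C(n,j) x^(n-j) (pascal-closed-form); defining it by Pascal's rule is what makes
-- pascal 0ℚ the identity and the product rule pascal-product provable by induction on n.
pascal : ℚ → ℕ → ℕ → ℚ
pascal x zero    zero    = 1ℚ
pascal x zero    (suc j) = 0ℚ
pascal x (suc n) j       = x * pascal x n j + shift (pascal x n) j

pascal-zero : ∀ n j → pascal 0ℚ n j ≡ δ n j
pascal-zero zero    zero    = refl
pascal-zero zero    (suc j) = refl
pascal-zero (suc n) zero    = trans (ℚₚ.+-identityʳ _) (ℚₚ.*-zeroˡ (pascal 0ℚ n zero))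
pascal-zero (suc n) (suc j) =
  trans (cong₂ _+_ (ℚₚ.*-zeroˡ (pascal 0ℚ n (suc j))) (pascal-zero n j)) (ℚₚ.+-identityˡ (δ n j))

pascal-neg : ∀ x n j → pascal (- x) n j ≡ neg1^ n * (neg1^ j * pascal x n j)
pascal-neg x zero    zero    = refl
pascal-neg x zero    (suc j) = solve 1 (λ s → con 0ℚ := con 1ℚ :* (:- s :* con 0ℚ)) refl (neg1^ j)
  where open +-*-Solver
pascal-neg x (suc n) zero    =
  trans (cong (λ p → - x * p + 0ℚ) (pascal-neg x n zero))
        (solve 3 (λ x s p → :- x :* (s :* (con 1ℚ :* p)) :+ con 0ℚ
                            := :- s :* (con 1ℚ :* (x :* p :+ con 0ℚ)))
               refl x (neg1^ n) (pascal x n zero))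
  where open +-*-Solver
pascal-neg x (suc n) (suc j) =
  trans (cong₂ (λ p q → - x * p + q) (pascal-neg x n (suc j)) (pascal-neg x n j))
        (solve 5 (λ x s t p q → :- x :* (s :* (:- t :* p)) :+ s :* (t :* q)
                                := :- s :* (:- t :* (x :* p :+ q)))
               refl x (neg1^ n) (neg1^ j) (pascal x n (suc j)) (pascal x n j))
  where open +-*-Solver

neg1^-pascal : ∀ x k j → neg1^ k * pascal x k j ≡ neg1^ j * pascal (- x) k j
neg1^-pascal x k j = sym (begin
  neg1^ j * pascal (- x) k j
    ≡⟨ cong (neg1^ j *_) (pascal-neg x k j) ⟩
  neg1^ j * (neg1^ k * (neg1^ j * pascal x k j))
    ≡⟨ solve 3 (λ t s p → t :* (s :* (t :* p)) := s :* (t :* (t :* p))) refl (neg1^ j) (neg1^ k) (pascal x k j) ⟩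
  neg1^ k * (neg1^ j * (neg1^ j * pascal x k j))
    ≡⟨ cong (neg1^ k *_) (neg1^-involutive j (pascal x k j)) ⟩
  neg1^ k * pascal x k j
    ∎)
  where open +-*-Solver

power-binomial-shift : ∀ a n k → a ℕ.* (a ^ (n ∸ suc k) ℕ.* (n C suc k)) ≡ a ^ (n ∸ k) ℕ.* (n C suc k)
power-binomial-shift a n k with suc k ≤? n
... | yes k<n =
  trans (sym (ℕₚ.*-assoc a _ _)) (cong (λ e → a ^ e ℕ.* (n C suc k)) (sym (ℕₚ.+-∸-assoc 1 k<n)))
... | no  k≮n rewrite k>n⇒nCk≡0 (ℕₚ.≰⇒> k≮n) =
  trans (cong (a ℕ.*_) (ℕₚ.*-zeroʳ (a ^ (n ∸ suc k))))
        (trans (ℕₚ.*-zeroʳ a) (sym (ℕₚ.*-zeroʳ (a ^ (n ∸ k)))))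

power-binomial-pascal : ∀ a n k → a ℕ.* (a ^ (n ∸ suc k) ℕ.* (n C suc k)) ℕ.+ a ^ (n ∸ k) ℕ.* (n C k)
                                  ≡ a ^ (n ∸ k) ℕ.* (suc n C suc k)
power-binomial-pascal a n k = begin
  a ℕ.* (a ^ (n ∸ suc k) ℕ.* c′) ℕ.+ p ℕ.* c ≡⟨ cong (ℕ._+ p ℕ.* c) (power-binomial-shift a n k) ⟩
  p ℕ.* c′ ℕ.+ p ℕ.* c                       ≡⟨ sym (ℕₚ.*-distribˡ-+ p c′ c) ⟩
  p ℕ.* (c′ ℕ.+ c)                           ≡⟨ cong (p ℕ.*_) (ℕₚ.+-comm c′ c) ⟩
  p ℕ.* (c ℕ.+ c′)                           ≡⟨ cong (p ℕ.*_) (nCk+nC[k+1]≡[n+1]C[k+1] n k) ⟩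
  p ℕ.* (suc n C suc k)                      ∎
  where
  p = a ^ (n ∸ k)
  c = n C k
  c′ = n C suc k

pascal-closed-form : ∀ a n k → pascal (ℕ→ℚ a) n k ≡ ℕ→ℚ (a ^ (n ∸ k) ℕ.* (n C k))
pascal-closed-form a zero    zero    = refl
pascal-closed-form a zero    (suc k) = refl
pascal-closed-form a (suc n) zero    = begin
  ℕ→ℚ a * pascal (ℕ→ℚ a) n zero + 0ℚ   ≡⟨ ℚₚ.+-identityʳ _ ⟩
  ℕ→ℚ a * pascal (ℕ→ℚ a) n zero        ≡⟨ cong (ℕ→ℚ a *_) (pascal-closed-form a n zero) ⟩
  ℕ→ℚ a * ℕ→ℚ (a ^ n ℕ.* 1)            ≡⟨ sym (ℕ→ℚ-homo-* a (a ^ n ℕ.* 1)) ⟩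
  ℕ→ℚ (a ℕ.* (a ^ n ℕ.* 1))            ≡⟨ cong ℕ→ℚ (sym (ℕₚ.*-assoc a (a ^ n) 1)) ⟩
  ℕ→ℚ (a ^ suc n ℕ.* 1)                ∎
pascal-closed-form a (suc n) (suc k) = begin
  ℕ→ℚ a * pascal (ℕ→ℚ a) n (suc k) + pascal (ℕ→ℚ a) n k
    ≡⟨ cong₂ (λ p q → ℕ→ℚ a * p + q) (pascal-closed-form a n (suc k)) (pascal-closed-form a n k) ⟩
  ℕ→ℚ a * ℕ→ℚ u + ℕ→ℚ v      ≡⟨ cong (_+ ℕ→ℚ v) (sym (ℕ→ℚ-homo-* a u)) ⟩
  ℕ→ℚ (a ℕ.* u) + ℕ→ℚ v      ≡⟨ sym (ℕ→ℚ-homo-+ (a ℕ.* u) v) ⟩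
  ℕ→ℚ (a ℕ.* u ℕ.+ v)        ≡⟨ cong ℕ→ℚ (power-binomial-pascal a n k) ⟩
  ℕ→ℚ (a ^ (n ∸ k) ℕ.* (suc n C suc k))
    ∎
  where
  u = a ^ (n ∸ suc k) ℕ.* (n C suc k)
  v = a ^ (n ∸ k) ℕ.* (n C k)

pascal-one : ∀ n k → pascal 1ℚ n k ≡ ℕ→ℚ (n C k)
pascal-one n k = trans (pascal-closed-form 1 n k)
  (cong ℕ→ℚ (trans (cong (ℕ._* (n C k)) (ℕₚ.^-zeroˡ (n ∸ k))) (ℕₚ.*-identityˡ (n C k))))

-- Where the binomial coefficient vanishes, the (possibly negative) exponent e is irrelevant.
two^-pascal : ∀ {e} n k → (k ≤ n → e ≡ + (n ∸ k)) → two^ e * ℕ→ℚ (n C k) ≡ pascal (ℕ→ℚ 2) n k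
two^-pascal {e} n k exponent = begin
  two^ e * ℕ→ℚ (n C k)                  ≡⟨ two^-exponent ⟩
  ℕ→ℚ (2 ^ (n ∸ k)) * ℕ→ℚ (n C k)       ≡⟨ sym (ℕ→ℚ-homo-* (2 ^ (n ∸ k)) (n C k)) ⟩
  ℕ→ℚ (2 ^ (n ∸ k) ℕ.* (n C k))         ≡⟨ sym (pascal-closed-form 2 n k) ⟩
  pascal (ℕ→ℚ 2) n k                    ∎
  where
  two^-exponent : two^ e * ℕ→ℚ (n C k) ≡ ℕ→ℚ (2 ^ (n ∸ k)) * ℕ→ℚ (n C k)
  two^-exponent with k ≤? n
  ... | yes k≤n = cong (λ e → two^ e * ℕ→ℚ (n C k)) (exponent k≤n)
  ... | no  k≰n rewrite k>n⇒nCk≡0 (ℕₚ.≰⇒> k≰n) =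
    trans (ℚₚ.*-zeroʳ (two^ e)) (sym (ℚₚ.*-zeroʳ (ℕ→ℚ (2 ^ (n ∸ k)))))

pascal-row-suc : ∀ x n B (g : ℕ → ℚ) →
  ∑[ k < suc B ] (pascal x (suc n) (toℕ k) * g (toℕ k))
    ≡ x * ∑[ k < suc B ] (pascal x n (toℕ k) * g (toℕ k))
      + ∑[ k < B ] (pascal x n (toℕ k) * g (suc (toℕ k)))
pascal-row-suc x n B g = begin
  (x * P 0 + 0ℚ) * g 0 + ∑[ k < B ] ((x * P′ k + P (toℕ k)) * g′ k)
    ≡⟨ cong (_+_ ((x * P 0 + 0ℚ) * g 0)) (sum-cong-≗ {B} distribute) ⟩
  (x * P 0 + 0ℚ) * g 0 + ∑[ k < B ] (x * (P′ k * g′ k) + P (toℕ k) * g′ k)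
    ≡⟨ cong (_+_ ((x * P 0 + 0ℚ) * g 0)) (∑-linear {B} x _ _) ⟩
  (x * P 0 + 0ℚ) * g 0 + (x * ∑[ k < B ] (P′ k * g′ k) + ∑[ k < B ] (P (toℕ k) * g′ k))
    ≡⟨ solve 5 (λ x p g s t → (x :* p :+ con 0ℚ) :* g :+ (x :* s :+ t) := x :* (p :* g :+ s) :+ t) refl
               x (P 0) (g 0) (∑[ k < B ] (P′ k * g′ k)) (∑[ k < B ] (P (toℕ k) * g′ k)) ⟩
  x * ∑[ k < suc B ] (P (toℕ k) * g (toℕ k)) + ∑[ k < B ] (P (toℕ k) * g′ k)
    ∎
  where
  open +-*-Solver
  P = pascal x n
  P′ g′ : Fin B → ℚ
  P′ k = P (suc (toℕ k))
  g′ k = g (suc (toℕ k))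
  distribute : ∀ k → (x * P′ k + P (toℕ k)) * g′ k ≡ x * (P′ k * g′ k) + P (toℕ k) * g′ k
  distribute k = solve 4 (λ x p q g → (x :* p :+ q) :* g := x :* (p :* g) :+ q :* g)
                         refl x (P′ k) (P (toℕ k)) (g′ k)

pascal-product : ∀ x y n j {B} → n < B →
                 ∑[ k < B ] (pascal x n (toℕ k) * pascal y (toℕ k) j) ≡ pascal (x + y) n j
pascal-product x y zero j {suc B} _ = begin
  1ℚ * pascal y zero j + ∑[ k < B ] (0ℚ * pascal y (suc (toℕ k)) j)
    ≡⟨ cong₂ _+_ (ℚₚ.*-identityˡ (pascal y zero j))
                 (trans (sum-cong-≗ {B} (λ k → ℚₚ.*-zeroˡ (pascal y (suc (toℕ k)) j)))
                        (sum-replicate-zero B)) ⟩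
  pascal y zero j + 0ℚ
    ≡⟨ ℚₚ.+-identityʳ (pascal y zero j) ⟩
  pascal y zero j
    ≡⟨ row-zero j ⟩
  pascal (x + y) zero j
    ∎
  where
  row-zero : ∀ j → pascal y zero j ≡ pascal (x + y) zero j
  row-zero zero    = refl
  row-zero (suc j) = refl
pascal-product x y (suc n) j {suc B} (s≤s n<B) = begin
  ∑[ k < suc B ] (pascal x (suc n) (toℕ k) * pascal y (toℕ k) j)
    ≡⟨ pascal-row-suc x n B (λ k → pascal y k j) ⟩
  x * ∑[ k < suc B ] (p k * pascal y (toℕ k) j) + ∑[ k < B ] (p k * pascal y (suc (toℕ k)) j)
    ≡⟨ cong₂ (λ s t → x * s + t) (pascal-product x y n j (ℕₚ.m<n⇒m<1+n n<B)) column-suc ⟩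
  x * pascal (x + y) n j + (y * pascal (x + y) n j + shift (pascal (x + y) n) j)
    ≡⟨ solve 4 (λ x y p s → x :* p :+ (y :* p :+ s) := (x :+ y) :* p :+ s) refl
               x y (pascal (x + y) n j) (shift (pascal (x + y) n) j) ⟩
  pascal (x + y) (suc n) j
    ∎
  where
  open +-*-Solver
  p : ∀ {B} → Fin B → ℚ
  p k = pascal x n (toℕ k)
  shifted : ∀ j → ∑[ k < B ] (p k * shift (pascal y (toℕ k)) j) ≡ shift (pascal (x + y) n) j
  shifted zero    = trans (sum-cong-≗ {B} (λ k → ℚₚ.*-zeroʳ (p k))) (sum-replicate-zero B)
  shifted (suc j) = pascal-product x y n j n<B
  column-suc : ∑[ k < B ] (p k * pascal y (suc (toℕ k)) j)
               ≡ y * pascal (x + y) n j + shift (pascal (x + y) n) j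
  column-suc = begin
    ∑[ k < B ] (p k * (y * pascal y (toℕ k) j + shift (pascal y (toℕ k)) j))
      ≡⟨ sum-cong-≗ {B} (λ k → solve 4 (λ p y q s → p :* (y :* q :+ s) := y :* (p :* q) :+ p :* s)
                                         refl (p k) y (pascal y (toℕ k) j) (shift (pascal y (toℕ k)) j)) ⟩
    ∑[ k < B ] (y * (p k * pascal y (toℕ k) j) + p k * shift (pascal y (toℕ k)) j)
      ≡⟨ ∑-linear {B} y _ _ ⟩
    y * ∑[ k < B ] (p k * pascal y (toℕ k) j) + ∑[ k < B ] (p k * shift (pascal y (toℕ k)) j)
      ≡⟨ cong₂ (λ s t → y * s + t) (pascal-product x y n j n<B) (shifted j) ⟩
    y * pascal (x + y) n j + shift (pascal (x + y) n) j
      ∎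

pascal-product-alternating : ∀ x n j {B} → n < B →
  ∑[ k < B ] (pascal x n (toℕ k) * (neg1^ (toℕ k) * pascal 1ℚ (toℕ k) j))
    ≡ neg1^ j * pascal (x + - 1ℚ) n j
pascal-product-alternating x n j {B} n<B = begin
  ∑[ k < B ] (pascal x n (toℕ k) * (neg1^ (toℕ k) * pascal 1ℚ (toℕ k) j))
    ≡⟨ sum-cong-≗ {B} (λ k → trans (cong (pascal x n (toℕ k) *_) (neg1^-pascal 1ℚ (toℕ k) j))
                                   (solve 3 (λ p s q → p :* (s :* q) := s :* (p :* q)) refl
                                            (pascal x n (toℕ k)) (neg1^ j) (pascal (- 1ℚ) (toℕ k) j))) ⟩
  ∑[ k < B ] (neg1^ j * (pascal x n (toℕ k) * pascal (- 1ℚ) (toℕ k) j))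
    ≡⟨ sym (*-distribˡ-sum {B} (neg1^ j) (λ k → pascal x n (toℕ k) * pascal (- 1ℚ) (toℕ k) j)) ⟩
  neg1^ j * ∑[ k < B ] (pascal x n (toℕ k) * pascal (- 1ℚ) (toℕ k) j)
    ≡⟨ cong (neg1^ j *_) (pascal-product x (- 1ℚ) n j n<B) ⟩
  neg1^ j * pascal (x + - 1ℚ) n j
    ∎
  where open +-*-Solver

coordinates-by-rightInverse : ∀ {m} (B E : Family m) →
  (∀ k l → ∑[ j < suc m ] (B k j * E j l) ≡ δ (toℕ k) (toℕ l)) →
  ∀ (κ : Vec′ m) l → κ l ≡ ∑[ j < suc m ] (lincomb κ B j * E j l)
coordinates-by-rightInverse {m} B E BE≡I κ l = begin
  κ l
    ≡⟨ sym (sum-δ κ l) ⟩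
  ∑[ k < suc m ] (κ k * δ (toℕ k) (toℕ l))
    ≡⟨ sum-cong-≗ {suc m} (λ k → cong (κ k *_) (sym (BE≡I k l))) ⟩
  ∑[ k < suc m ] (κ k * ∑[ j < suc m ] (B k j * E j l))
    ≡⟨ sum-cong-≗ {suc m} (λ k → *-distribˡ-sum (κ k) (λ j → B k j * E j l)) ⟩
  ∑[ k < suc m ] ∑[ j < suc m ] (κ k * (B k j * E j l))
    ≡⟨ ∑-comm (λ k j → κ k * (B k j * E j l)) ⟩
  ∑[ j < suc m ] ∑[ k < suc m ] (κ k * (B k j * E j l))
    ≡⟨ sum-cong-≗ {suc m} (λ j → sum-cong-≗ {suc m} (λ k → sym (ℚₚ.*-assoc (κ k) (B k j) (E j l)))) ⟩
  ∑[ j < suc m ] ∑[ k < suc m ] (κ k * B k j * E j l)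
    ≡⟨ sum-cong-≗ {suc m} (λ j → sym (*-distribʳ-sum (E j l) (λ k → κ k * B k j))) ⟩
  ∑[ j < suc m ] (∑[ k < suc m ] (κ k * B k j) * E j l)
    ≡⟨ sum-cong-≗ {suc m} (λ j → cong (_* E j l) (sym (Σ≡sum (λ k → κ k * B k j)))) ⟩
  ∑[ j < suc m ] (lincomb κ B j * E j l)
    ∎

rightInverse⇒IsChangeOfBasisMatrix : ∀ {m} (B B′ : Family m) (C E : Matrix m) →
  (∀ k l → ∑[ j < suc m ] (B k j * E j l) ≡ δ (toℕ k) (toℕ l)) →
  (∀ i j → lincomb (C i) B j ≡ B′ i j) →
  IsChangeOfBasisMatrix B B′ C
rightInverse⇒IsChangeOfBasisMatrix {m} B B′ C E BE≡I C-expands i = C-expands i , unique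
  where
  coordinates : ∀ (κ : Vec′ m) l → κ l ≡ ∑[ j < suc m ] (lincomb κ B j * E j l)
  coordinates = coordinates-by-rightInverse B E BE≡I
  unique : ∀ (κ : Vec′ m) → (∀ j → lincomb κ B j ≡ B′ i j) → ∀ k → κ k ≡ C i k
  unique κ κ-expands k = begin
    κ k
      ≡⟨ coordinates κ k ⟩
    ∑[ j < suc m ] (lincomb κ B j * E j k)
      ≡⟨ sum-cong-≗ {suc m} (λ j → cong (_* E j k) (trans (κ-expands j) (sym (C-expands i j)))) ⟩
    ∑[ j < suc m ] (lincomb (C i) B j * E j k)
      ≡⟨ sym (coordinates (C i) k) ⟩
    C i k
      ∎

[+m]-[+n]≡+[m∸n] : ∀ {m n} → n ≤ m → + m ℤ.- + n ≡ + (m ∸ n)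
[+m]-[+n]≡+[m∸n] {m} {n} n≤m = trans (ℤₚ.m-n≡m⊖n m n) (ℤₚ.⊖-≥ n≤m)

F▲-pascal : ∀ m k j → F▲ m k j ≡ pascal 1ℚ (toℕ k) (toℕ j)
F▲-pascal m k j = sym (pascal-one (toℕ k) (toℕ j))

H▲-pascal : ∀ m i j → H▲ m i j ≡ neg1^ (toℕ j) * pascal 1ℚ (m ∸ toℕ i) (toℕ j)
H▲-pascal m i j = cong (neg1^ (toℕ j) *_) (sym (pascal-one (m ∸ toℕ i) (toℕ j)))

M₁-pascal : ∀ m i k → M₁ m i k ≡ neg1^ (toℕ k) * pascal (ℕ→ℚ 2) (m ∸ toℕ i) (toℕ k)
M₁-pascal m i k = cong (neg1^ K *_) (two^-pascal (m ∸ I) K exponent)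
  where
  I = toℕ i
  K = toℕ k
  open ℤ-Solver.+-*-Solver
  exponent : K ≤ m ∸ I → + m ℤ.- + K ℤ.- + I ≡ + (m ∸ I ∸ K)
  exponent K≤m∸I = begin
    + m ℤ.- + K ℤ.- + I  ≡⟨ solve 3 (λ m k i → m :- k :- i := m :- i :- k) refl (+ m) (+ K) (+ I) ⟩
    + m ℤ.- + I ℤ.- + K  ≡⟨ cong (ℤ._- + K) ([+m]-[+n]≡+[m∸n] (toℕ≤pred[n] i)) ⟩
    + (m ∸ I) ℤ.- + K    ≡⟨ [+m]-[+n]≡+[m∸n] K≤m∸I ⟩
    + (m ∸ I ∸ K)        ∎

M₂-pascal : ∀ m i k → M₂ m i k ≡ neg1^ (m ∸ toℕ k) * pascal (ℕ→ℚ 2) (toℕ i) (m ∸ toℕ k)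
M₂-pascal m i k = cong (neg1^ (m ∸ K) *_) (two^-pascal I (m ∸ K) exponent)
  where
  I = toℕ i
  K = toℕ k
  open ℤ-Solver.+-*-Solver
  exponent : m ∸ K ≤ I → + I ℤ.+ + K ℤ.- + m ≡ + (I ∸ (m ∸ K))
  exponent m∸K≤I = begin
    + I ℤ.+ + K ℤ.- + m      ≡⟨ solve 3 (λ i k m → i :+ k :- m := i :- (m :- k)) refl (+ I) (+ K) (+ m) ⟩
    + I ℤ.- (+ m ℤ.- + K)    ≡⟨ cong (ℤ._-_ (+ I)) ([+m]-[+n]≡+[m∸n] (toℕ≤pred[n] k)) ⟩
    + I ℤ.- + (m ∸ K)        ≡⟨ [+m]-[+n]≡+[m∸n] m∸K≤I ⟩
    + (I ∸ (m ∸ K))          ∎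

lincomb-M₁-F▲ : ∀ m i j → lincomb (M₁ m i) (F▲ m) j ≡ H▲ m i j
lincomb-M₁-F▲ m i j = begin
  lincomb (M₁ m i) (F▲ m) j
    ≡⟨ Σ≡sum (λ k → M₁ m i k * F▲ m k j) ⟩
  ∑[ k < suc m ] (M₁ m i k * F▲ m k j)
    ≡⟨ sum-cong-≗ {suc m} (λ k → trans (cong₂ _*_ (M₁-pascal m i k) (F▲-pascal m k j)) (regroup (toℕ k))) ⟩
  ∑[ k < suc m ] (pascal (ℕ→ℚ 2) N (toℕ k) * (neg1^ (toℕ k) * pascal 1ℚ (toℕ k) J))
    ≡⟨ pascal-product-alternating (ℕ→ℚ 2) N J (s≤s (ℕₚ.m∸n≤m m (toℕ i))) ⟩
  neg1^ J * pascal 1ℚ N J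
    ≡⟨ sym (H▲-pascal m i j) ⟩
  H▲ m i j
    ∎
  where
  open +-*-Solver
  N = m ∸ toℕ i
  J = toℕ j
  regroup : ∀ k → neg1^ k * pascal (ℕ→ℚ 2) N k * pascal 1ℚ k J
                  ≡ pascal (ℕ→ℚ 2) N k * (neg1^ k * pascal 1ℚ k J)
  regroup k = solve 3 (λ s p q → s :* p :* q := p :* (s :* q)) refl (neg1^ k) (pascal (ℕ→ℚ 2) N k) (pascal 1ℚ k J)

lincomb-M₂-H▲ : ∀ m i j → lincomb (M₂ m i) (H▲ m) j ≡ F▲ m i j
lincomb-M₂-H▲ m i j = begin
  lincomb (M₂ m i) (H▲ m) j
    ≡⟨ Σ≡sum (λ k → M₂ m i k * H▲ m k j) ⟩
  ∑[ k < suc m ] (M₂ m i k * H▲ m k j)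
    ≡⟨ sum-cong-≗ {suc m} (λ k → trans (cong₂ _*_ (M₂-pascal m i k) (H▲-pascal m k j)) (regroup (m ∸ toℕ k))) ⟩
  ∑[ k < suc m ] (neg1^ J * term (m ∸ toℕ k))
    ≡⟨ sym (*-distribˡ-sum {suc m} (neg1^ J) (λ k → term (m ∸ toℕ k))) ⟩
  neg1^ J * ∑[ k < suc m ] term (m ∸ toℕ k)
    ≡⟨ cong (neg1^ J *_) (sum-reverse m term) ⟩
  neg1^ J * ∑[ k < suc m ] term (toℕ k)
    ≡⟨ cong (neg1^ J *_) (pascal-product-alternating (ℕ→ℚ 2) I J (s≤s (toℕ≤pred[n] i))) ⟩
  neg1^ J * (neg1^ J * pascal 1ℚ I J)
    ≡⟨ neg1^-involutive J (pascal 1ℚ I J) ⟩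
  pascal 1ℚ I J
    ≡⟨ sym (F▲-pascal m i j) ⟩
  F▲ m i j
    ∎
  where
  open +-*-Solver
  I = toℕ i
  J = toℕ j
  term : ℕ → ℚ
  term l = pascal (ℕ→ℚ 2) I l * (neg1^ l * pascal 1ℚ l J)
  regroup : ∀ l → neg1^ l * pascal (ℕ→ℚ 2) I l * (neg1^ J * pascal 1ℚ l J) ≡ neg1^ J * term l
  regroup l = solve 4 (λ s p t q → s :* p :* (t :* q) := t :* (p :* (s :* q)))
                      refl (neg1^ l) (pascal (ℕ→ℚ 2) I l) (neg1^ J) (pascal 1ℚ l J)

F▲⁻¹ : (m : ℕ) → Matrix m
F▲⁻¹ m j l = pascal (- 1ℚ) (toℕ j) (toℕ l)

H▲⁻¹ : (m : ℕ) → Matrix m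
H▲⁻¹ m j l = neg1^ (toℕ j) * pascal (- 1ℚ) (toℕ j) (m ∸ toℕ l)

F▲-rightInverse : ∀ m k l → ∑[ j < suc m ] (F▲ m k j * F▲⁻¹ m j l) ≡ δ (toℕ k) (toℕ l)
F▲-rightInverse m k l = begin
  ∑[ j < suc m ] (F▲ m k j * F▲⁻¹ m j l)
    ≡⟨ sum-cong-≗ {suc m} (λ j → cong (_* F▲⁻¹ m j l) (F▲-pascal m k j)) ⟩
  ∑[ j < suc m ] (pascal 1ℚ (toℕ k) (toℕ j) * pascal (- 1ℚ) (toℕ j) (toℕ l))
    ≡⟨ pascal-product 1ℚ (- 1ℚ) (toℕ k) (toℕ l) (s≤s (toℕ≤pred[n] k)) ⟩
  pascal 0ℚ (toℕ k) (toℕ l)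
    ≡⟨ pascal-zero (toℕ k) (toℕ l) ⟩
  δ (toℕ k) (toℕ l)
    ∎

H▲-rightInverse : ∀ m k l → ∑[ j < suc m ] (H▲ m k j * H▲⁻¹ m j l) ≡ δ (toℕ k) (toℕ l)
H▲-rightInverse m k l = begin
  ∑[ j < suc m ] (H▲ m k j * H▲⁻¹ m j l)
    ≡⟨ sum-cong-≗ {suc m} (λ j → trans (cong (_* H▲⁻¹ m j l) (H▲-pascal m k j)) (signs-cancel (toℕ j))) ⟩
  ∑[ j < suc m ] (pascal 1ℚ (m ∸ toℕ k) (toℕ j) * pascal (- 1ℚ) (toℕ j) (m ∸ toℕ l))
    ≡⟨ pascal-product 1ℚ (- 1ℚ) (m ∸ toℕ k) (m ∸ toℕ l) (s≤s (ℕₚ.m∸n≤m m (toℕ k))) ⟩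
  pascal 0ℚ (m ∸ toℕ k) (m ∸ toℕ l)
    ≡⟨ pascal-zero (m ∸ toℕ k) (m ∸ toℕ l) ⟩
  δ (m ∸ toℕ k) (m ∸ toℕ l)
    ≡⟨ δ-∸ (toℕ≤pred[n] k) (toℕ≤pred[n] l) ⟩
  δ (toℕ k) (toℕ l)
    ∎
  where
  open +-*-Solver
  signs-cancel : ∀ j → neg1^ j * pascal 1ℚ (m ∸ toℕ k) j * (neg1^ j * pascal (- 1ℚ) j (m ∸ toℕ l))
                       ≡ pascal 1ℚ (m ∸ toℕ k) j * pascal (- 1ℚ) j (m ∸ toℕ l)
  signs-cancel j = trans (solve 3 (λ s p q → s :* p :* (s :* q) := s :* (s :* (p :* q))) refl
                                  (neg1^ j) (pascal 1ℚ (m ∸ toℕ k) j) (pascal (- 1ℚ) j (m ∸ toℕ l)))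
                         (neg1^-involutive j _)

mainTheorem1 : (m : ℕ) → .{{_ : NonZero m}} →
    IsChangeOfBasisMatrix (F▲ m) (H▲ m) (M₁ m)
      × IsChangeOfBasisMatrix (H▲ m) (F▲ m) (M₂ m)
mainTheorem1 m =
    rightInverse⇒IsChangeOfBasisMatrix (F▲ m) (H▲ m) (M₁ m) (F▲⁻¹ m) (F▲-rightInverse m) (lincomb-M₁-F▲ m)
  , rightInverse⇒IsChangeOfBasisMatrix (H▲ m) (F▲ m) (M₂ m) (H▲⁻¹ m) (H▲-rightInverse m) (lincomb-M₂-H▲ m)
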